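{- Let $G$ be a finite group, $\alpha$ an involutory automorphism of $G$, $H$ a subgroup of $G$, $\beta\in\mathrm{Aut}(G)$, $\alpha^\beta=\beta\alpha\beta^{ -1}$, and $g\in G$ with $\alpha^\beta(g)=g$. If $H$ is a perfect code of $GC(G,S,\alpha)$ for some generalized Cayley subset $S$ of $G$ induced by $\alpha$, then $g^{ -1}\beta(H)g$ is a perfect code of $GC(G,g^{ -1}\beta(S)g,\alpha^\beta)$.
   Context: $G$ is a finite group with identity $e$; an involutory automorphism of $G$ is $\gamma\in\mathrm{Aut}(G)$ with $\gamma^2=\mathrm{id}\neq\gamma$. For such $\gamma$, set $\omega_\gamma(G)=\{\gamma(x^{ -1})x\mid x\in G\}$. A subset $S\subseteq G$ is a generalized Cayley subset of $G$ induced by $\gamma$ if $S\cap\omega_\gamma(G)=\emptyset$ and $\gamma(S)=S^{ -1}$ (where $\gamma(A)=\{\gamma(a)\mid a\in A\}$, $A^{ -1}=\{a^{ -1}\mid a\in A\}$). The generalized Cayley graph $GC(G,S,\gamma)$ has vertex set $G$ and edge set $\{\{x,y\}\mid \gamma(x^{ -1})y\in S\}$. A subset $C$ of the vertex set of a graph is a perfect code if $C$ is independent and every vertex outside $C$ is adjacent to exactly one vertex of $C$. $g^{ -1}Ag=\{g^{ -1}ag\mid a\in A\}$. -}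

module Defs where

open import Data.Product using (Σ; ∃; _×_; _,_)
open import Data.Sum using (_⊎_)
open import Data.List using (List)
open import Data.List.Membership.Propositional using (_∈_)
open import Relation.Nullary using (¬_)
open import Relation.Binary.PropositionalEquality using (_≡_)
open import Function.Bundles using (_⇔_)

-- A finite group (equality is propositional; finiteness = an explicit
-- list enumerating every element).
record FiniteGroup : Set₁ where
  infixl 7 _∙_
  field
    Carrier  : Set
    _∙_      : Carrier → Carrier → Carrier
    e        : Carrier
    _⁻¹      : Carrier → Carrier
    assoc    : ∀ x y z → (x ∙ y) ∙ z ≡ x ∙ (y ∙ z)
    identityˡ : ∀ x → e ∙ x ≡ x
    identityʳ : ∀ x → x ∙ e ≡ x
    inverseˡ : ∀ x → (x ⁻¹) ∙ x ≡ e
    inverseʳ : ∀ x → x ∙ (x ⁻¹) ≡ e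
    elements : List Carrier
    complete : ∀ x → x ∈ elements

module _ (G : FiniteGroup) where
  open FiniteGroup G

  Subset : Set₁
  Subset = Carrier → Set

  record IsSubgroup (H : Subset) : Set where
    field
      has-e    : H e
      closed-∙ : ∀ {x y} → H x → H y → H (x ∙ y)
      closed-⁻¹ : ∀ {x} → H x → H (x ⁻¹)

  record Aut : Set where
    field
      to      : Carrier → Carrier
      from    : Carrier → Carrier
      to-from : ∀ x → to (from x) ≡ x
      from-to : ∀ x → from (to x) ≡ x
      hom     : ∀ x y → to (x ∙ y) ≡ to x ∙ to y

  IsInvolutory : Aut → Set
  IsInvolutory γ = (∀ x → Aut.to γ (Aut.to γ x) ≡ x) × ¬ (∀ x → Aut.to γ x ≡ x)

  conjAut : Aut → Aut → Aut
  conjAut α β = record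
    { to      = λ x → B (A (B⁻ x))
    ; from    = λ x → B (A⁻ (B⁻ x))
    ; to-from = λ x → to-from-proof x
    ; from-to = λ x → from-to-proof x
    ; hom     = λ x y → hom-proof x y
    }
    where
    open Aut α renaming (to to A; from to A⁻; to-from to Atf; from-to to Aft; hom to Ahom)
    open Aut β renaming (to to B; from to B⁻; to-from to Btf; from-to to Bft; hom to Bhom)
    open import Relation.Binary.PropositionalEquality using (cong; trans; sym)
    to-from-proof : ∀ x → B (A (B⁻ (B (A⁻ (B⁻ x))))) ≡ x
    to-from-proof x = trans (cong (λ z → B (A z)) (Bft (A⁻ (B⁻ x))))
                        (trans (cong B (Atf (B⁻ x))) (Btf x))
    from-to-proof : ∀ x → B (A⁻ (B⁻ (B (A (B⁻ x))))) ≡ x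
    from-to-proof x = trans (cong (λ z → B (A⁻ z)) (Bft (A (B⁻ x))))
                        (trans (cong B (Aft (B⁻ x))) (Btf x))
    B⁻hom : ∀ x y → B⁻ (x ∙ y) ≡ B⁻ x ∙ B⁻ y
    B⁻hom x y = trans (cong B⁻ (sym (trans (Bhom (B⁻ x) (B⁻ y))
                   (trans (cong (_∙ B (B⁻ y)) (Btf x)) (cong (x ∙_) (Btf y))))))
                   (Bft (B⁻ x ∙ B⁻ y))
    hom-proof : ∀ x y → B (A (B⁻ (x ∙ y))) ≡ B (A (B⁻ x)) ∙ B (A (B⁻ y))
    hom-proof x y = trans (cong (λ z → B (A z)) (B⁻hom x y))
                      (trans (cong B (Ahom (B⁻ x) (B⁻ y))) (Bhom (A (B⁻ x)) (A (B⁻ y))))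

  image : (Carrier → Carrier) → Subset → Subset
  image f A x = ∃ λ a → A a × x ≡ f a

  inverseSet : Subset → Subset
  inverseSet A x = ∃ λ a → A a × x ≡ a ⁻¹

  conjSet : Carrier → Subset → Subset
  conjSet g A x = ∃ λ a → A a × x ≡ (g ⁻¹) ∙ a ∙ g

  ω : Aut → Subset
  ω γ y = ∃ λ x → y ≡ Aut.to γ (x ⁻¹) ∙ x

  IsGCSubset : Aut → Subset → Set
  IsGCSubset γ S = (∀ x → S x → ¬ ω γ x)
                 × (∀ x → image (Aut.to γ) S x ⇔ inverseSet S x)

  GCAdj : Subset → Aut → Carrier → Carrier → Set
  GCAdj S γ x y = S (Aut.to γ (x ⁻¹) ∙ y) ⊎ S (Aut.to γ (y ⁻¹) ∙ x)

  IsPerfectCode : Subset → Aut → Subset → Set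
  IsPerfectCode S γ C =
      (∀ c c′ → C c → C c′ → ¬ GCAdj S γ c c′)
    × (∀ v → ¬ C v →
         ∃ λ c → (C c × GCAdj S γ v c)
               × (∀ c′ → C c′ → GCAdj S γ v c′ → c′ ≡ c))

{-# OPTIONS --safe #-}
-- The map φ x = g⁻¹ β(x) g is an automorphism of G with α^β ∘ φ = φ ∘ α, because α^β fixes g
-- and α^β ∘ β = β ∘ α.  Hence α^β(φ(x)⁻¹) φ(y) = φ(α(x⁻¹) y), so φ is a graph isomorphism
-- from GC(G,S,α) onto GC(G,φ(S),α^β), and graph isomorphisms carry perfect codes to perfect
-- codes.
module Submission where

open import Algebra.Bundles using (Group)
import Algebra.Properties.Group as GroupProperties
import Algebra.Properties.Monoid as MonoidProperties
open import Data.Product using (∃; _×_; _,_)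
open import Data.Sum.Function.Propositional using (_⊎-cong_)
open import Function using (_⇔_; mk⇔; Equivalence)
open import Function.Construct.Composition using (_⇔-∘_)
open import Level using (0ℓ)
open import Relation.Binary.PropositionalEquality
open import Relation.Nullary using (¬_)

open import Defs

-- IsPerfectCode G S γ unfolds to IsPerfectCodeOf (GCAdj G S γ).
IsPerfectCodeOf : {V : Set} → (V → V → Set) → (V → Set) → Set
IsPerfectCodeOf Adj C =
    (∀ c c′ → C c → C c′ → ¬ Adj c c′)
  × (∀ v → ¬ C v →
       ∃ λ c → (C c × Adj v c) × (∀ c′ → C c′ → Adj v c′ → c′ ≡ c))

perfectCode-transport :
  {V W : Set} {Adj : V → V → Set} {Adj′ : W → W → Set} {C : V → Set} {C′ : W → Set}
  (φ : V → W) (ψ : W → V) → (∀ w → φ (ψ w) ≡ w) →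
  (∀ x y → Adj′ (φ x) (φ y) ⇔ Adj x y) → (∀ v → C′ (φ v) ⇔ C v) →
  IsPerfectCodeOf Adj C → IsPerfectCodeOf Adj′ C′
perfectCode-transport {Adj = Adj} {Adj′} {C = C} {C′} φ ψ φψ adj code (independent , cover) =
  independent′ , cover′
  where
  open ≡-Reasoning

  C′⇒C∘ψ : ∀ {w} → C′ w → C (ψ w)
  C′⇒C∘ψ {w} w∈C′ = Equivalence.to (code (ψ w)) (subst C′ (sym (φψ w)) w∈C′)

  C∘ψ⇒C′ : ∀ {w} → C (ψ w) → C′ w
  C∘ψ⇒C′ {w} ψw∈C = subst C′ (φψ w) (Equivalence.from (code (ψ w)) ψw∈C)

  Adj′⇒Adj∘ψ : ∀ {w w′} → Adj′ w w′ → Adj (ψ w) (ψ w′)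
  Adj′⇒Adj∘ψ {w} {w′} w~w′ =
    Equivalence.to (adj (ψ w) (ψ w′)) (subst₂ Adj′ (sym (φψ w)) (sym (φψ w′)) w~w′)

  independent′ : ∀ c c′ → C′ c → C′ c′ → ¬ Adj′ c c′
  independent′ c c′ c∈C′ c′∈C′ c~c′ =
    independent (ψ c) (ψ c′) (C′⇒C∘ψ c∈C′) (C′⇒C∘ψ c′∈C′) (Adj′⇒Adj∘ψ c~c′)

  cover′ : ∀ v → ¬ C′ v →
    ∃ λ c → (C′ c × Adj′ v c) × (∀ c′ → C′ c′ → Adj′ v c′ → c′ ≡ c)
  cover′ v v∉C′ with cover (ψ v) (λ ψv∈C → v∉C′ (C∘ψ⇒C′ ψv∈C))
  ... | c , (c∈C , ψv~c) , unique = φ c , (Equivalence.from (code c) c∈C , v~φc) , unique′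
    where
    v~φc : Adj′ v (φ c)
    v~φc = subst (λ w → Adj′ w (φ c)) (φψ v) (Equivalence.from (adj (ψ v) c) ψv~c)

    unique′ : ∀ c′ → C′ c′ → Adj′ v c′ → c′ ≡ φ c
    unique′ c′ c′∈C′ v~c′ = begin
      c′       ≡⟨ φψ c′ ⟨
      φ (ψ c′) ≡⟨ cong φ (unique (ψ c′) (C′⇒C∘ψ c′∈C′) (Adj′⇒Adj∘ψ v~c′)) ⟩
      φ c      ∎

toGroup : FiniteGroup → Group 0ℓ 0ℓ
toGroup G = record
  { Carrier = Carrier ; _≈_ = _≡_ ; _∙_ = _∙_ ; ε = e ; _⁻¹ = _⁻¹
  ; isGroup = record
    { isMonoid = record
      { isSemigroup = record
        { isMagma = record { isEquivalence = isEquivalence ; ∙-cong = cong₂ _∙_ }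
        ; assoc = assoc }
      ; identity = identityˡ , identityʳ }
    ; inverse = inverseˡ , inverseʳ
    ; ⁻¹-cong = cong _⁻¹ }
  }
  where open FiniteGroup G

module Automorphisms (G : FiniteGroup) where
  open FiniteGroup G
  open GroupProperties (toGroup G) using (inverseʳ-unique; identityˡ-unique)
  open MonoidProperties (Group.monoid (toGroup G)) using (cancelˡ; cancelʳ; cancelᶜ)
  open Aut
  open ≡-Reasoning

  aut-e : (φ : Aut G) → to φ e ≡ e
  aut-e φ = identityˡ-unique (to φ e) (to φ e)
    (trans (sym (hom φ e e)) (cong (to φ) (identityˡ e)))

  aut-⁻¹ : (φ : Aut G) → ∀ x → to φ (x ⁻¹) ≡ to φ x ⁻¹
  aut-⁻¹ φ x = inverseʳ-unique (to φ x) (to φ (x ⁻¹)) (begin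
    to φ x ∙ to φ (x ⁻¹) ≡⟨ hom φ x (x ⁻¹) ⟨
    to φ (x ∙ x ⁻¹)      ≡⟨ cong (to φ) (inverseʳ x) ⟩
    to φ e               ≡⟨ aut-e φ ⟩
    e                    ∎)

  infixr 9 _∘ᴬ_
  _∘ᴬ_ : Aut G → Aut G → Aut G
  φ ∘ᴬ ψ = record
    { to      = λ x → to φ (to ψ x)
    ; from    = λ x → from ψ (from φ x)
    ; to-from = λ x → trans (cong (to φ) (to-from ψ (from φ x))) (to-from φ x)
    ; from-to = λ x → trans (cong (from ψ) (from-to φ (to ψ x))) (from-to ψ x)
    ; hom     = λ x y → trans (cong (to φ) (hom ψ x y)) (hom φ (to ψ x) (to ψ y))
    }

  cancel-sandwich : ∀ {a b c d} → a ∙ b ≡ e → c ∙ d ≡ e → ∀ x → (a ∙ ((b ∙ x) ∙ c)) ∙ d ≡ x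
  cancel-sandwich {a} {b} {c} {d} ab≡e cd≡e x = begin
    (a ∙ ((b ∙ x) ∙ c)) ∙ d ≡⟨ cong (_∙ d) (assoc a (b ∙ x) c) ⟨
    ((a ∙ (b ∙ x)) ∙ c) ∙ d ≡⟨ cong (λ y → (y ∙ c) ∙ d) (cancelˡ ab≡e x) ⟩
    (x ∙ c) ∙ d             ≡⟨ cancelʳ cd≡e x ⟩
    x                       ∎

  inner : Carrier → Aut G
  inner g = record
    { to      = λ x → g ⁻¹ ∙ x ∙ g
    ; from    = λ x → g ∙ x ∙ g ⁻¹
    ; to-from = cancel-sandwich (inverseˡ g) (inverseˡ g)
    ; from-to = cancel-sandwich (inverseʳ g) (inverseʳ g)
    ; hom     = λ x y → begin
        g ⁻¹ ∙ (x ∙ y) ∙ g             ≡⟨ cong (_∙ g) (assoc (g ⁻¹) x y) ⟨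
        g ⁻¹ ∙ x ∙ y ∙ g               ≡⟨ assoc (g ⁻¹ ∙ x) y g ⟩
        (g ⁻¹ ∙ x) ∙ (y ∙ g)           ≡⟨ cancelᶜ (inverseʳ g) (g ⁻¹ ∙ x) (y ∙ g) ⟨
        (g ⁻¹ ∙ x ∙ g) ∙ (g ⁻¹ ∙ (y ∙ g)) ≡⟨ cong (g ⁻¹ ∙ x ∙ g ∙_) (assoc (g ⁻¹) y g) ⟨
        (g ⁻¹ ∙ x ∙ g) ∙ (g ⁻¹ ∙ y ∙ g)   ∎
    }

  to-injective : (φ : Aut G) → ∀ {x y} → to φ x ≡ to φ y → x ≡ y
  to-injective φ {x} {y} φx≡φy = begin
    x               ≡⟨ from-to φ x ⟨
    from φ (to φ x) ≡⟨ cong (from φ) φx≡φy ⟩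
    from φ (to φ y) ≡⟨ from-to φ y ⟩
    y               ∎

  conjAut-∘ : (α β : Aut G) → ∀ x → to (conjAut G α β) (to β x) ≡ to β (to α x)
  conjAut-∘ α β x = cong (λ y → to β (to α y)) (from-to β x)

  inner-commute : (γ : Aut G) {g : Carrier} → to γ g ≡ g →
    ∀ x → to γ (to (inner g) x) ≡ to (inner g) (to γ x)
  inner-commute γ {g} γg≡g x = begin
    to γ (g ⁻¹ ∙ x ∙ g)           ≡⟨ hom γ (g ⁻¹ ∙ x) g ⟩
    to γ (g ⁻¹ ∙ x) ∙ to γ g      ≡⟨ cong (_∙ to γ g) (hom γ (g ⁻¹) x) ⟩
    to γ (g ⁻¹) ∙ to γ x ∙ to γ g ≡⟨ cong₂ (λ u v → u ∙ to γ x ∙ v) γg⁻¹≡g⁻¹ γg≡g ⟩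
    g ⁻¹ ∙ to γ x ∙ g             ∎
    where
    γg⁻¹≡g⁻¹ : to γ (g ⁻¹) ≡ g ⁻¹
    γg⁻¹≡g⁻¹ = trans (aut-⁻¹ γ g) (cong _⁻¹ γg≡g)

  image-aut⇔ : (φ : Aut G) (T : Subset G) → ∀ z → image G (to φ) T (to φ z) ⇔ T z
  image-aut⇔ φ T z = mk⇔
    (λ { (t , t∈T , φz≡φt) → subst T (sym (to-injective φ φz≡φt)) t∈T })
    (λ z∈T → z , z∈T , refl)

  conjSet-image⇔ : (g : Carrier) (f : Carrier → Carrier) (T : Subset G) →
    ∀ x → conjSet G g (image G f T) x ⇔ image G (λ y → to (inner g) (f y)) T x
  conjSet-image⇔ g f T x = mk⇔
    (λ { (a , (t , t∈T , a≡ft) , x≡a^g) → t , t∈T , trans x≡a^g (cong (to (inner g)) a≡ft) })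
    (λ { (t , t∈T , x≡ft^g) → f t , (t , t∈T , refl) , x≡ft^g })

  conjSet-image-aut⇔ : (g : Carrier) (β : Aut G) (T : Subset G) →
    ∀ z → conjSet G g (image G (to β) T) (to (inner g ∘ᴬ β) z) ⇔ T z
  conjSet-image-aut⇔ g β T z =
    image-aut⇔ (inner g ∘ᴬ β) T z ⇔-∘ conjSet-image⇔ g (to β) T (to (inner g ∘ᴬ β) z)

  GCAdj-transport : (φ α α′ : Aut G) → (∀ x → to α′ (to φ x) ≡ to φ (to α x)) →
    (S S′ : Subset G) → (∀ z → S′ (to φ z) ⇔ S z) →
    ∀ x y → GCAdj G S′ α′ (to φ x) (to φ y) ⇔ GCAdj G S α x y
  GCAdj-transport φ α α′ intertwines S S′ S′∘φ⇔S x y = arc x y ⊎-cong arc y x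
    where
    arc-label : ∀ x y → to α′ (to φ x ⁻¹) ∙ to φ y ≡ to φ (to α (x ⁻¹) ∙ y)
    arc-label x y = begin
      to α′ (to φ x ⁻¹) ∙ to φ y   ≡⟨ cong (λ z → to α′ z ∙ to φ y) (aut-⁻¹ φ x) ⟨
      to α′ (to φ (x ⁻¹)) ∙ to φ y ≡⟨ cong (_∙ to φ y) (intertwines (x ⁻¹)) ⟩
      to φ (to α (x ⁻¹)) ∙ to φ y  ≡⟨ hom φ (to α (x ⁻¹)) y ⟨
      to φ (to α (x ⁻¹) ∙ y)       ∎

    arc : ∀ x y → S′ (to α′ (to φ x ⁻¹) ∙ to φ y) ⇔ S (to α (x ⁻¹) ∙ y)
    arc x y = subst (λ z → S′ z ⇔ S (to α (x ⁻¹) ∙ y)) (sym (arc-label x y)) (S′∘φ⇔S _)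

proposition2p12 : (G : FiniteGroup) (α : Aut G) → IsInvolutory G α →
    (H : Subset G) → IsSubgroup G H → (β : Aut G) →
    (g : FiniteGroup.Carrier G) → Aut.to (conjAut G α β) g ≡ g →
    (S : Subset G) → IsGCSubset G α S → IsPerfectCode G S α H →
    IsPerfectCode G (conjSet G g (image G (Aut.to β) S)) (conjAut G α β)
      (conjSet G g (image G (Aut.to β) H))
proposition2p12 G α _ H _ β g αᵝg≡g S _ =
  perfectCode-transport (to φ) (from φ) (to-from φ)
    (GCAdj-transport φ α αᵝ intertwines S S′ (conjSet-image-aut⇔ g β S))
    (conjSet-image-aut⇔ g β H)
  where
  open Automorphisms G
  open Aut

  αᵝ φ : Aut G
  αᵝ = conjAut G α β
  φ = inner g ∘ᴬ β

  S′ : Subset G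
  S′ = conjSet G g (image G (to β) S)

  intertwines : ∀ x → to αᵝ (to φ x) ≡ to φ (to α x)
  intertwines x = trans (inner-commute αᵝ αᵝg≡g (to β x))
                        (cong (to (inner g)) (conjAut-∘ α β x))
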